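{- Let $\Gamma$ be a distance-regular graph with diameter $D\ge3$ and $a_1\ne0$. Let $\sigma_0,\dots,\sigma_D$ and $\rho_0,\dots,\rho_D$ be nontrivial pseudo cosine sequences forming a tight pair, and let $\varepsilon$ be a real number with $\sigma_i\rho_i-\sigma_{i-1}\rho_{i-1}=\varepsilon(\sigma_{i-1}\rho_i-\sigma_i\rho_{i-1})$ for $1\le i\le D$. Then $\varepsilon\notin\{1,-1\}$. Moreover $\sigma_{i-1}\ne\sigma_i$ and $\rho_{i-1}\ne\rho_i$ for $1\le i\le D$.
   Context: $\Gamma$ is a finite, undirected, connected graph without loops or multiple edges, with path-length distance $\partial$ and diameter $D$. It is distance-regular: for all $0\le h,i,j\le D$ and all vertices $x,y$ with $\partial(x,y)=h$, the number $p^h_{ij}$ of vertices $z$ with $\partial(x,z)=i$, $\partial(y,z)=j$ depends only on $h,i,j$. Write $a_i=p^i_{1i}$, $b_i=p^i_{1,i+1}$ $(0\le i\le D-1)$, $c_i=p^i_{1,i-1}$ $(1\le i\le D)$, $c_0=0$, $b_D=0$, $k=b_0$. A pseudo cosine sequence (for $\theta\in\mathbb{R}$) is a sequence of reals $\sigma_0,\dots,\sigma_D$ with $\sigma_0=1$ and $c_i\sigma_{i-1}+a_i\sigma_i+b_i\sigma_{i+1}=\theta\sigma_i$ for $0\le i\le D-1$ (with $c_0\sigma_{ -1}=0$). It is trivial if it is the one for $\theta=k$ (all entries $1$), nontrivial otherwise. Two pseudo cosine sequences $\sigma_i,\rho_i$ form a tight pair if $\sigma_0\rho_0,\dots,\sigma_D\rho_D$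 is a pseudo cosine sequence. -}

module Defs where

open import Level using (Level; _⊔_) renaming (suc to lsuc)
open import Data.Nat as ℕ using (ℕ; zero; suc)
open import Data.Bool using (Bool; true; false; _∧_; _∨_; not)
open import Data.Fin using (Fin)
open import Data.Fin.Properties using () renaming (_≟_ to _≟ᶠ_)
open import Data.List using (List; length; filterᵇ; allFin)
open import Data.Bool.ListAction using (any)
open import Data.Vec using (Vec; []; _∷_)
open import Data.Product using (Σ; ∃; _×_; _,_)
open import Relation.Nullary using (¬_; does)
open import Relation.Binary.PropositionalEquality using (_≡_)
open import Relation.Binary.Structures using (IsTotalOrder)
open import Algebra.Bundles using (CommutativeRing)

module RingOps {c ℓ} (R : CommutativeRing c ℓ) where
  open CommutativeRing R

  pow : Carrier → ℕ → Carrier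
  pow x zero    = 1#
  pow x (suc m) = x * pow x m

  eval : ∀ {m} → Vec Carrier m → Carrier → Carrier
  eval []       x = 0#
  eval (a ∷ as) x = a + x * eval as x

  ι : ℕ → Carrier
  ι zero    = 0#
  ι (suc m) = 1# + ι m

-- By Tarski transfer, the
-- first-order statement below holds over ℝ iff it holds over every real
-- closed field; ℝ itself is not available in agda-stdlib.

record RealClosedField (c ℓ : Level) : Set (lsuc (c ⊔ ℓ)) where
  field
    commutativeRing : CommutativeRing c ℓ
  open CommutativeRing commutativeRing public
  open RingOps commutativeRing public
  field
    _≤_            : Carrier → Carrier → Set ℓ
    ≤-isTotalOrder : IsTotalOrder _≈_ _≤_
    +-mono-≤       : ∀ {x y} z → x ≤ y → (x + z) ≤ (y + z)
    *-nonneg       : ∀ {x y} → 0# ≤ x → 0# ≤ y → 0# ≤ (x * y)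
    0≉1            : ¬ (0# ≈ 1#)
    inverse        : ∀ x → ¬ (x ≈ 0#) → ∃ λ y → (x * y) ≈ 1#
    sqrt           : ∀ x → 0# ≤ x → ∃ λ y → (y * y) ≈ x
    odd-root       : ∀ m (a : Vec Carrier (suc (2 ℕ.* m))) →
                     ∃ λ x → (pow x (suc (2 ℕ.* m)) + eval a x) ≈ 0#

record Graph (n : ℕ) : Set where
  field
    adj     : Fin n → Fin n → Bool
    symm    : ∀ x y → adj x y ≡ adj y x
    irrefl  : ∀ x → adj x x ≡ false

module GraphOps {n : ℕ} (G : Graph n) where
  open Graph G

  within : ℕ → Fin n → Fin n → Bool
  within zero    x y = does (x ≟ᶠ y)
  within (suc m) x y = within m x y ∨ any (λ z → adj x z ∧ within m z y) (allFin n)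

  isDist : Fin n → Fin n → ℕ → Bool
  isDist x y zero    = within zero x y
  isDist x y (suc d) = within (suc d) x y ∧ not (within d x y)

  count : Fin n → Fin n → ℕ → ℕ → ℕ
  count x y i j = length (filterᵇ (λ z → isDist x z i ∧ isDist y z j) (allFin n))

record DistanceRegular (n D : ℕ) : Set where
  field
    graph : Graph n
  open GraphOps graph public
  field
    within-D  : ∀ x y → within D x y ≡ true
    diam-attained : Σ (Fin n) λ x → Σ (Fin n) λ y → isDist x y D ≡ true
    p         : ℕ → ℕ → ℕ → ℕ
    regular   : ∀ h i j → h ℕ.≤ D → i ℕ.≤ D → j ℕ.≤ D →
                ∀ x y → isDist x y h ≡ true → count x y i j ≡ p h i j

  a : ℕ → ℕ
  a i = p i 1 i
  b : ℕ → ℕ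
  b i = p i 1 (suc i)
  c : ℕ → ℕ      -- c 0 is not used
  c i = p i 1 (i ℕ.∸ 1)
  k : ℕ
  k = b 0

-- Pseudo cosine sequences (indices 0..D of σ : ℕ → F are relevant)

module Cosine {c ℓ} (F : RealClosedField c ℓ) {n D : ℕ} (Γ : DistanceRegular n D) where
  open RealClosedField F
  open DistanceRegular Γ using (a; b; k; p)

  -- c_i σ_{i-1}, with the convention c_0 σ_{-1} = 0
  cterm : (ℕ → Carrier) → ℕ → Carrier
  cterm σ zero    = 0#
  cterm σ (suc i) = ι (p (suc i) 1 i) * σ i

  IsPseudoCosine : Carrier → (ℕ → Carrier) → Set ℓ
  IsPseudoCosine θ σ =
    (σ 0 ≈ 1#) ×
    (∀ i → suc i ℕ.≤ D →
       (cterm σ i + ι (a i) * σ i + ι (b i) * σ (suc i)) ≈ (θ * σ i))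

  Nontrivial : (ℕ → Carrier) → Set (c ⊔ ℓ)
  Nontrivial σ = ∃ λ θ → IsPseudoCosine θ σ × ¬ (θ ≈ ι k)

  PseudoCosine : (ℕ → Carrier) → Set (c ⊔ ℓ)
  PseudoCosine σ = ∃ λ θ → IsPseudoCosine θ σ

  TightPair : (ℕ → Carrier) → (ℕ → Carrier) → Set (c ⊔ ℓ)
  TightPair σ ρ = PseudoCosine σ × PseudoCosine ρ × PseudoCosine (λ i → σ i * ρ i)

{-# OPTIONS --safe #-}
module Submission where

-- Since a₀ = 0 and b₀ = k, the recurrence at 0 gives θ = k σ₁ for every pseudo cosine
-- sequence, so a nontrivial one has σ₁ ≠ 1.  With a + b + c = k, a flat step σᵢ = σᵢ₊₁
-- (i ≥ 1) turns the recurrence at i into c (σᵢ₋₁ − σᵢ) = (θ − k) σᵢ.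
--
-- For ε = 1 the relation reads (σᵢ₊₁ − σᵢ)(ρᵢ₊₁ + ρᵢ) = 0.  Then ρ₁ = −1, and the
-- recurrence of ρ at 1 gives b₁ (ρ₂ + ρ₁) = 2a₁ ≠ 0, hence σ₂ = σ₁.  Two consecutive flat
-- steps would force θ = k, so ρ₃ = −ρ₂, and the recurrence of ρ at 2 gives
-- (2a₂ + c₂) ρ₂ = c₂.  Eliminating ρ₂ leaves 2 (a₂b₁ + a₁ (2a₂ + c₂)) = 0, impossible since
-- intersection numbers are nonnegative and a₁c₂ > 0.  The relation is invariant under
-- (σ, ρ, ε) ↦ (ρ, σ, −ε), which reduces ε = −1 to ε = 1.
--
-- If σᵢ = σᵢ₊₁ and ε ≠ 1, the relation forces ρᵢ = ρᵢ₊₁ as well (σᵢ ≠ 0, because a pseudo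
-- cosine sequence has no two consecutive zeros).  The flat-step identities of σ, ρ and of
-- the product σρ, whose eigenvalue is η = k σ₁ρ₁, combine to
-- k (k − c)(σ₁ − 1)(ρ₁ − 1) σᵢρᵢ = 0, and every factor is nonzero.

open import Defs
open import Data.Nat using (ℕ; suc; _≤_)
open import Data.Product using (_×_)
open import Relation.Nullary using (¬_)
open import Relation.Binary.PropositionalEquality using (_≢_)

open import Data.Nat as ℕ using (zero; _<_; z≤n; s≤s)
import Data.Nat.Properties as ℕ
open import Data.Integer as ℤ using (ℤ; +_; -[1+_]; _⊖_)
import Data.Integer.Properties as ℤ
open import Data.Sign as Sign using (Sign)
open import Data.Bool using (Bool; true; false; T; T?; _∧_; not)
open import Data.Bool.Properties using (T-≡; T-∧; T-∨)
open import Data.Unit using (tt)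
open import Data.Fin using (Fin)
open import Data.Fin.Properties using () renaming (_≟_ to _≟ᶠ_)
open import Data.List using ([]; _∷_; length; filterᵇ; allFin)
import Data.List.Properties as List
open import Data.List.Membership.Propositional using (lose)
open import Data.List.Membership.Propositional.Properties using (∈-allFin)
open import Data.List.Relation.Unary.Any using (satisfied)
open import Data.List.Relation.Unary.Any.Properties using (any⁺; any⁻)
import Data.List.Relation.Unary.All as All
open import Data.Maybe using (Maybe; just; nothing)
open import Data.Product using (∃; ∃₂; _,_; proj₁; proj₂)
open import Data.Sum using (_⊎_; inj₁; inj₂)
open import Function using (_∘_; Equivalence)
open import Relation.Nullary using (Dec; does; yes; no; contradiction)
open import Relation.Binary.PropositionalEquality as ≡ using (_≡_)
open import Relation.Binary.Structures using (IsTotalOrder)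
open import Relation.Binary.Bundles using (Poset)
open import Algebra.Bundles using (CommutativeRing)
open import Algebra.Solver.Ring.AlmostCommutativeRing
  using (_-Raw-AlmostCommutative⟶_; fromCommutativeRing)
import Algebra.Solver.Ring as RingSolver
import Algebra.Properties.Ring as RingProperties
import Algebra.Properties.CommutativeSemigroup as CommutativeSemigroupProperties
import Algebra.Properties.Semiring.Mult.TCOptimised as MultiplicationProperties
import Relation.Binary.Reasoning.Setoid as SetoidReasoning
import Relation.Binary.Reasoning.PartialOrder as PosetReasoning

-- The carrier of an arbitrary commutative ring has no decidable equality, so the ring
-- solver normalises with integer coefficients, mapped in by ⟦_⟧.  ⟦_⟧ uses the
-- TC-optimised multiple _·_ (where 1 · x = x), so that the numeral con (+ 1) denotes 1#
-- itself and solved equations match hypotheses mentioning 1# definitionally.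
module IntegerCoefficientRingSolver {c ℓ} (R : CommutativeRing c ℓ) where
  open CommutativeRing R
  open RingProperties ring using (-1*x≈-x; -‿involutive; -0#≈0#; -‿+-comm)
  open CommutativeSemigroupProperties *-commutativeSemigroup using (interchange)
  open MultiplicationProperties semiring using (1+×; ×-homo-+; ×1-homo-*) renaming (_×_ to _·_)
  open SetoidReasoning setoid

  ⟦_⟧ : ℤ → Carrier
  ⟦ + n ⟧      = n · 1#
  ⟦ -[1+ n ] ⟧ = - (suc n · 1#)

  sgn : Sign → Carrier
  sgn Sign.+ = 1#
  sgn Sign.- = - 1#

  sgn-homo-* : ∀ s t → sgn (s Sign.* t) ≈ sgn s * sgn t
  sgn-homo-* Sign.+ t      = sym (*-identityˡ (sgn t))
  sgn-homo-* Sign.- Sign.+ = sym (*-identityʳ (- 1#))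
  sgn-homo-* Sign.- Sign.- = begin
    1#          ≈⟨ -‿involutive 1# ⟨
    - - 1#      ≈⟨ -1*x≈-x (- 1#) ⟨
    - 1# * - 1# ∎

  ⟦◃⟧ : ∀ s n → ⟦ s ℤ.◃ n ⟧ ≈ sgn s * (n · 1#)
  ⟦◃⟧ s      zero    = sym (zeroʳ (sgn s))
  ⟦◃⟧ Sign.+ (suc n) = sym (*-identityˡ (suc n · 1#))
  ⟦◃⟧ Sign.- (suc n) = sym (-1*x≈-x (suc n · 1#))

  ⟦⟧≈sign*abs : ∀ i → ⟦ i ⟧ ≈ sgn (ℤ.sign i) * (ℤ.∣ i ∣ · 1#)
  ⟦⟧≈sign*abs (+ n)    = sym (*-identityˡ (n · 1#))
  ⟦⟧≈sign*abs -[1+ n ] = sym (-1*x≈-x (suc n · 1#))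

  ⟦⊖⟧ : ∀ m n → ⟦ m ⊖ n ⟧ ≈ m · 1# - n · 1#
  ⟦⊖⟧ zero    zero    = sym (-‿inverseʳ 0#)
  ⟦⊖⟧ (suc m) zero    = sym (trans (+-congˡ -0#≈0#) (+-identityʳ (suc m · 1#)))
  ⟦⊖⟧ zero    (suc n) = sym (+-identityˡ (- (suc n · 1#)))
  ⟦⊖⟧ (suc m) (suc n) = begin
    ⟦ suc m ⊖ suc n ⟧                   ≡⟨ ≡.cong ⟦_⟧ (ℤ.[1+m]⊖[1+n]≡m⊖n m n) ⟩
    ⟦ m ⊖ n ⟧                           ≈⟨ ⟦⊖⟧ m n ⟩
    m · 1# - n · 1#                     ≈⟨ +-identityˡ (m · 1# - n · 1#) ⟨
    0# + (m · 1# - n · 1#)              ≈⟨ +-congʳ (-‿inverseʳ 1#) ⟨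
    (1# - 1#) + (m · 1# - n · 1#)       ≈⟨ +-interchange 1# (- 1#) (m · 1#) (- (n · 1#)) ⟩
    (1# + m · 1#) + (- 1# - n · 1#)
      ≈⟨ +-cong (1+× m 1#) (trans (-‿cong (1+× n 1#)) (sym (-‿+-comm 1# (n · 1#)))) ⟨
    suc m · 1# - suc n · 1#             ∎
    where open CommutativeSemigroupProperties +-commutativeSemigroup
                 using () renaming (interchange to +-interchange)

  ⟦⟧-homo-+ : ∀ i j → ⟦ i ℤ.+ j ⟧ ≈ ⟦ i ⟧ + ⟦ j ⟧
  ⟦⟧-homo-+ (+ m)    (+ n)    = ×-homo-+ 1# m n
  ⟦⟧-homo-+ (+ m)    -[1+ n ] = ⟦⊖⟧ m (suc n)
  ⟦⟧-homo-+ -[1+ m ] (+ n)    = trans (⟦⊖⟧ n (suc m)) (+-comm (n · 1#) (- (suc m · 1#)))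
  ⟦⟧-homo-+ -[1+ m ] -[1+ n ] = begin
    - (suc (suc (m ℕ.+ n)) · 1#)        ≡⟨ ≡.cong (λ t → - (suc t · 1#)) (ℕ.+-suc m n) ⟨
    - ((suc m ℕ.+ suc n) · 1#)          ≈⟨ -‿cong (×-homo-+ 1# (suc m) (suc n)) ⟩
    - (suc m · 1# + suc n · 1#)         ≈⟨ -‿+-comm (suc m · 1#) (suc n · 1#) ⟨
    - (suc m · 1#) + - (suc n · 1#)     ∎

  ⟦⟧-homo-* : ∀ i j → ⟦ i ℤ.* j ⟧ ≈ ⟦ i ⟧ * ⟦ j ⟧
  ⟦⟧-homo-* i j = begin
    ⟦ (s Sign.* t) ℤ.◃ (∣i∣ ℕ.* ∣j∣) ⟧           ≈⟨ ⟦◃⟧ (s Sign.* t) (∣i∣ ℕ.* ∣j∣) ⟩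
    sgn (s Sign.* t) * ((∣i∣ ℕ.* ∣j∣) · 1#)       ≈⟨ *-cong (sgn-homo-* s t) (×1-homo-* ∣i∣ ∣j∣) ⟩
    (sgn s * sgn t) * ((∣i∣ · 1#) * (∣j∣ · 1#))   ≈⟨ interchange (sgn s) (sgn t) (∣i∣ · 1#) (∣j∣ · 1#) ⟩
    (sgn s * (∣i∣ · 1#)) * (sgn t * (∣j∣ · 1#))   ≈⟨ *-cong (⟦⟧≈sign*abs i) (⟦⟧≈sign*abs j) ⟨
    ⟦ i ⟧ * ⟦ j ⟧                                ∎
    where
    s t : Sign
    s = ℤ.sign i
    t = ℤ.sign j
    ∣i∣ ∣j∣ : ℕ
    ∣i∣ = ℤ.∣ i ∣
    ∣j∣ = ℤ.∣ j ∣

  ⟦⟧-homo-‿ : ∀ i → ⟦ ℤ.- i ⟧ ≈ - ⟦ i ⟧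
  ⟦⟧-homo-‿ (+ zero)  = sym -0#≈0#
  ⟦⟧-homo-‿ (+ suc n) = refl
  ⟦⟧-homo-‿ -[1+ n ]  = sym (-‿involutive (suc n · 1#))

  homomorphism : ℤ.+-*-rawRing -Raw-AlmostCommutative⟶ fromCommutativeRing R
  homomorphism = record
    { ⟦_⟧    = ⟦_⟧
    ; +-homo = ⟦⟧-homo-+
    ; *-homo = ⟦⟧-homo-*
    ; -‿homo = ⟦⟧-homo-‿
    ; 0-homo = refl
    ; 1-homo = refl
    }

  _≟⟦⟧_ : ∀ i j → Maybe (⟦ i ⟧ ≈ ⟦ j ⟧)
  i ≟⟦⟧ j with i ℤ.≟ j
  ... | yes ≡.refl = just refl
  ... | no _       = nothing

  open RingSolver ℤ.+-*-rawRing (fromCommutativeRing R) homomorphism _≟⟦⟧_ public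
    using (solve; _:=_; con; _:+_; _:*_; _:-_; :-_)

module CommutativeRingIdentities {c ℓ} (R : CommutativeRing c ℓ) where
  open CommutativeRing R
  open RingProperties ring using (x≈y⇒x∙y⁻¹≈ε; x∙y⁻¹≈ε⇒x≈y)
  open IntegerCoefficientRingSolver R

  private
    vanishes : ∀ q {x y} → x ≈ y → q * (x - y) ≈ 0#
    vanishes q x≈y = trans (*-congˡ (x≈y⇒x∙y⁻¹≈ε x≈y)) (zeroʳ q)

    infixl 6 _⊕_
    _⊕_ : ∀ {x y} → x ≈ 0# → y ≈ 0# → x + y ≈ 0#
    x≈0 ⊕ y≈0 = trans (+-cong x≈0 y≈0) (+-identityʳ 0#)

    -- Each identity below is proved by exhibiting lhs − rhs as a combination Σ qᵢ (lᵢ − rᵢ)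
    -- of its hypotheses lᵢ ≈ rᵢ, which the ring solver checks.
    by-certificate : ∀ {x y z} → x - y ≈ z → z ≈ 0# → x ≈ y
    by-certificate {x} {y} x-y≈z z≈0 = x∙y⁻¹≈ε⇒x≈y x y (trans x-y≈z z≈0)

  eigenvalue-from-first-step : ∀ {a₀ k θ x₀ x₁} →
    0# + a₀ * x₀ + k * x₁ ≈ θ * x₀ → x₀ ≈ 1# → a₀ ≈ 0# → θ ≈ k * x₁
  eigenvalue-from-first-step {a₀} {k} {θ} {x₀} {x₁} rec x₀≈1 a₀≈0 = by-certificate
    (solve 5 (λ a₀ k θ x₀ x₁ →
       θ :- k :* x₁
         := (θ :* x₀ :- (con (+ 0) :+ a₀ :* x₀ :+ k :* x₁))
            :+ (:- θ) :* (x₀ :- con (+ 1)) :+ x₀ :* (a₀ :- con (+ 0)))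
       refl a₀ k θ x₀ x₁)
    (x≈y⇒x∙y⁻¹≈ε (sym rec) ⊕ vanishes (- θ) x₀≈1 ⊕ vanishes x₀ a₀≈0)

  flat-step : ∀ {a b c k θ x′ x x⁺} →
    c * x′ + a * x + b * x⁺ ≈ θ * x → x ≈ x⁺ → a + b + c ≈ k → c * (x′ - x) ≈ (θ - k) * x
  flat-step {a} {b} {c} {k} {θ} {x′} {x} {x⁺} rec x≈x⁺ abc≈k = by-certificate
    (solve 8 (λ a b c k θ x′ x x⁺ →
       c :* (x′ :- x) :- (θ :- k) :* x
         := (c :* x′ :+ a :* x :+ b :* x⁺ :- θ :* x) :+ b :* (x :- x⁺) :+ (:- x) :* (a :+ b :+ c :- k))
       refl a b c k θ x′ x x⁺)
    (x≈y⇒x∙y⁻¹≈ε rec ⊕ vanishes b x≈x⁺ ⊕ vanishes (- x) abc≈k)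

  zero-steps-propagate : ∀ {a b c θ x′ x x⁺} →
    c * x′ + a * x + b * x⁺ ≈ θ * x → x ≈ 0# → x⁺ ≈ 0# → c * x′ ≈ 0#
  zero-steps-propagate {a} {b} {c} {θ} {x′} {x} {x⁺} rec x≈0 x⁺≈0 = by-certificate
    (solve 7 (λ a b c θ x′ x x⁺ →
       c :* x′ :- con (+ 0)
         := (c :* x′ :+ a :* x :+ b :* x⁺ :- θ :* x)
            :+ (θ :- a) :* (x :- con (+ 0)) :+ (:- b) :* (x⁺ :- con (+ 0)))
       refl a b c θ x′ x x⁺)
    (x≈y⇒x∙y⁻¹≈ε rec ⊕ vanishes (θ - a) x≈0 ⊕ vanishes (- b) x⁺≈0)

  x+y+z≈w⇒w-z≈x+y : ∀ {x y z w} → x + y + z ≈ w → w - z ≈ x + y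
  x+y+z≈w⇒w-z≈x+y {x} {y} {z} {w} x+y+z≈w = by-certificate
    (solve 4 (λ x y z w → w :- z :- (x :+ y) := w :- (x :+ y :+ z)) refl x y z w)
    (x≈y⇒x∙y⁻¹≈ε (sym x+y+z≈w))

  flat-steps-of-product : ∀ {c k θ τ η x′ x y′ y} →
    c * (x′ - x) ≈ (θ - k) * x → c * (y′ - y) ≈ (τ - k) * y → c * (x′ * y′ - x * y) ≈ (η - k) * (x * y) →
    (θ - k) * (τ - k) * (x * y) ≈ c * (η - θ - τ + k) * (x * y)
  flat-steps-of-product {c} {k} {θ} {τ} {η} {x′} {x} {y′} {y} x-step y-step xy-step = by-certificate
    (solve 9 (λ c k θ τ η x′ x y′ y →
       (θ :- k) :* (τ :- k) :* (x :* y) :- c :* (η :- θ :- τ :+ k) :* (x :* y)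
         := c :* (c :* (x′ :* y′ :- x :* y) :- (η :- k) :* (x :* y))
            :+ (:- (c :* y′)) :* (c :* (x′ :- x) :- (θ :- k) :* x)
            :+ (:- (x :* (c :+ θ :- k))) :* (c :* (y′ :- y) :- (τ :- k) :* y))
       refl c k θ τ η x′ x y′ y)
    (vanishes c xy-step ⊕ vanishes (- (c * y′)) x-step ⊕ vanishes (- (x * (c + θ - k))) y-step)

  flat-steps-of-product-eigenvalues : ∀ {c k θ τ η s t x y} →
    (θ - k) * (τ - k) * (x * y) ≈ c * (η - θ - τ + k) * (x * y) →
    θ ≈ k * s → τ ≈ k * t → η ≈ k * (s * t) →
    k * (k - c) * ((s - 1#) * (t - 1#)) * (x * y) ≈ 0#
  flat-steps-of-product-eigenvalues {c} {k} {θ} {τ} {η} {s} {t} {x} {y} steps θ≈ks τ≈kt η≈kst =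
    by-certificate
    (solve 9 (λ c k θ τ η s t x y →
       k :* (k :- c) :* ((s :- con (+ 1)) :* (t :- con (+ 1))) :* (x :* y) :- con (+ 0)
         := ((θ :- k) :* (τ :- k) :* (x :* y) :- c :* (η :- θ :- τ :+ k) :* (x :* y))
            :+ (:- (x :* y :* (τ :- k :+ c))) :* (θ :- k :* s)
            :+ (:- (x :* y :* (k :* s :- k :+ c))) :* (τ :- k :* t)
            :+ (c :* (x :* y)) :* (η :- k :* (s :* t)))
       refl c k θ τ η s t x y)
    (x≈y⇒x∙y⁻¹≈ε steps ⊕ vanishes (- (x * y * (τ - k + c))) θ≈ks
       ⊕ vanishes (- (x * y * (k * s - k + c))) τ≈kt ⊕ vanishes (c * (x * y)) η≈kst)

  StepRelation : Carrier → Carrier → Carrier → Carrier → Carrier → Set ℓ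
  StepRelation ε x₀ y₀ x₁ y₁ = x₁ * y₁ - x₀ * y₀ ≈ ε * (x₀ * y₁ - x₁ * y₀)

  step-relation-swap : ∀ {ε x₀ y₀ x₁ y₁} → StepRelation ε x₀ y₀ x₁ y₁ → StepRelation (- ε) y₀ x₀ y₁ x₁
  step-relation-swap {ε} {x₀} {y₀} {x₁} {y₁} rel = by-certificate
    (solve 5 (λ ε x₀ y₀ x₁ y₁ →
       y₁ :* x₁ :- y₀ :* x₀ :- (:- ε) :* (y₀ :* x₁ :- y₁ :* x₀)
         := x₁ :* y₁ :- x₀ :* y₀ :- ε :* (x₀ :* y₁ :- x₁ :* y₀))
       refl ε x₀ y₀ x₁ y₁)
    (x≈y⇒x∙y⁻¹≈ε rel)

  step-relation-ε≈1 : ∀ {ε x₀ y₀ x₁ y₁} →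
    StepRelation ε x₀ y₀ x₁ y₁ → ε ≈ 1# → (x₁ - x₀) * (y₁ + y₀) ≈ 0#
  step-relation-ε≈1 {ε} {x₀} {y₀} {x₁} {y₁} rel ε≈1 = by-certificate
    (solve 5 (λ ε x₀ y₀ x₁ y₁ →
       (x₁ :- x₀) :* (y₁ :+ y₀) :- con (+ 0)
         := (x₁ :* y₁ :- x₀ :* y₀ :- ε :* (x₀ :* y₁ :- x₁ :* y₀))
            :+ (x₀ :* y₁ :- x₁ :* y₀) :* (ε :- con (+ 1)))
       refl ε x₀ y₀ x₁ y₁)
    (x≈y⇒x∙y⁻¹≈ε rel ⊕ vanishes (x₀ * y₁ - x₁ * y₀) ε≈1)

  step-relation-flat : ∀ {ε x₀ y₀ x₁ y₁} →
    StepRelation ε x₀ y₀ x₁ y₁ → x₀ ≈ x₁ → (1# - ε) * (x₀ * (y₁ - y₀)) ≈ 0#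
  step-relation-flat {ε} {x₀} {y₀} {x₁} {y₁} rel x₀≈x₁ = by-certificate
    (solve 5 (λ ε x₀ y₀ x₁ y₁ →
       (con (+ 1) :- ε) :* (x₀ :* (y₁ :- y₀)) :- con (+ 0)
         := (x₁ :* y₁ :- x₀ :* y₀ :- ε :* (x₀ :* y₁ :- x₁ :* y₀)) :+ (y₁ :+ ε :* y₀) :* (x₀ :- x₁))
       refl ε x₀ y₀ x₁ y₁)
    (x≈y⇒x∙y⁻¹≈ε rel ⊕ vanishes (y₁ + ε * y₀) x₀≈x₁)

  sign-flip-second-step : ∀ {a b c k τ y₀ y₁ y₂} →
    c * y₀ + a * y₁ + b * y₂ ≈ τ * y₁ → y₀ ≈ 1# → y₁ ≈ - 1# → τ ≈ k * y₁ → a + b + c ≈ k →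
    b * (y₂ + y₁) ≈ a + a
  sign-flip-second-step {a} {b} {c} {k} {τ} {y₀} {y₁} {y₂} rec y₀≈1 y₁≈-1 τ≈ky₁ abc≈k = by-certificate
    (solve 8 (λ a b c k τ y₀ y₁ y₂ →
       b :* (y₂ :+ y₁) :- (a :+ a)
         := (c :* y₀ :+ a :* y₁ :+ b :* y₂ :- τ :* y₁) :+ y₁ :* (τ :- k :* y₁)
            :+ (k :* y₁ :- k :+ b :- a) :* (y₁ :- :- con (+ 1))
            :+ (:- c) :* (y₀ :- con (+ 1)) :+ (k :- (a :+ b :+ c)))
       refl a b c k τ y₀ y₁ y₂)
    (x≈y⇒x∙y⁻¹≈ε rec ⊕ vanishes y₁ τ≈ky₁ ⊕ vanishes (k * y₁ - k + b - a) y₁≈-1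
       ⊕ vanishes (- c) y₀≈1 ⊕ x≈y⇒x∙y⁻¹≈ε (sym abc≈k))

  sign-flip-third-step : ∀ {a b c k τ y₁ y₂ y₃} →
    c * y₁ + a * y₂ + b * y₃ ≈ τ * y₂ → y₃ + y₂ ≈ 0# → y₁ ≈ - 1# → τ ≈ k * y₁ → a + b + c ≈ k →
    (a + a + c) * y₂ ≈ c
  sign-flip-third-step {a} {b} {c} {k} {τ} {y₁} {y₂} {y₃} rec y₃+y₂≈0 y₁≈-1 τ≈ky₁ abc≈k = by-certificate
    (solve 8 (λ a b c k τ y₁ y₂ y₃ →
       (a :+ a :+ c) :* y₂ :- c
         := (c :* y₁ :+ a :* y₂ :+ b :* y₃ :- τ :* y₂) :+ (:- b) :* (y₃ :+ y₂ :- con (+ 0))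
            :+ y₂ :* (τ :- k :* y₁) :+ y₂ :* (a :+ b :+ c :- k)
            :+ (k :* y₂ :- c) :* (y₁ :- :- con (+ 1)))
       refl a b c k τ y₁ y₂ y₃)
    (x≈y⇒x∙y⁻¹≈ε rec ⊕ vanishes (- b) y₃+y₂≈0 ⊕ vanishes y₂ τ≈ky₁ ⊕ vanishes y₂ abc≈k
       ⊕ vanishes (k * y₂ - c) y₁≈-1)

  sign-flip-steps-incompatible : ∀ {a₁ b₁ a₂ c₂ y₁ y₂} →
    b₁ * (y₂ + y₁) ≈ a₁ + a₁ → (a₂ + a₂ + c₂) * y₂ ≈ c₂ → y₁ ≈ - 1# →
    (a₂ * b₁ + a₁ * (a₂ + a₂ + c₂)) + (a₂ * b₁ + a₁ * (a₂ + a₂ + c₂)) ≈ 0#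
  sign-flip-steps-incompatible {a₁} {b₁} {a₂} {c₂} {y₁} {y₂} second third y₁≈-1 = by-certificate
    (solve 6 (λ a₁ b₁ a₂ c₂ y₁ y₂ →
       (a₂ :* b₁ :+ a₁ :* (a₂ :+ a₂ :+ c₂)) :+ (a₂ :* b₁ :+ a₁ :* (a₂ :+ a₂ :+ c₂)) :- con (+ 0)
         := (a₂ :+ a₂ :+ c₂) :* (a₁ :+ a₁ :- b₁ :* (y₂ :+ y₁))
            :+ b₁ :* ((a₂ :+ a₂ :+ c₂) :* y₂ :- c₂)
            :+ (a₂ :+ a₂ :+ c₂) :* b₁ :* (y₁ :- :- con (+ 1)))
       refl a₁ b₁ a₂ c₂ y₁ y₂)
    (vanishes (a₂ + a₂ + c₂) (sym second) ⊕ vanishes b₁ third ⊕ vanishes ((a₂ + a₂ + c₂) * b₁) y₁≈-1)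

module OrderedFieldProperties {c ℓ} (F : RealClosedField c ℓ) where
  -- Data.Nat's _≤_ is in scope, and Defs declares no fixity for the field order.
  open RealClosedField F renaming (_≤_ to infix 4 _≤ᶠ_)
  open RingProperties ring using (-1*x≈-x; -‿involutive)
  open IsTotalOrder ≤-isTotalOrder using (isPartialOrder; total; antisym)

  private
    poset : Poset c ℓ ℓ
    poset = record { isPartialOrder = isPartialOrder }
  open PosetReasoning poset

  xy≈0⇒y≈0 : ∀ {x y} → ¬ x ≈ 0# → x * y ≈ 0# → y ≈ 0#
  xy≈0⇒y≈0 {x} {y} x≉0 xy≈0 with inverse x x≉0
  ... | x⁻¹ , xx⁻¹≈1 = begin-equality
    y               ≈⟨ *-identityˡ y ⟨
    1# * y          ≈⟨ *-congʳ (trans (sym xx⁻¹≈1) (*-comm x x⁻¹)) ⟩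
    (x⁻¹ * x) * y   ≈⟨ *-assoc x⁻¹ x y ⟩
    x⁻¹ * (x * y)   ≈⟨ *-congˡ xy≈0 ⟩
    x⁻¹ * 0#        ≈⟨ zeroʳ x⁻¹ ⟩
    0#              ∎

  xy≈0⇒x≈0 : ∀ {x y} → ¬ y ≈ 0# → x * y ≈ 0# → x ≈ 0#
  xy≈0⇒x≈0 {x} {y} y≉0 xy≈0 = xy≈0⇒y≈0 y≉0 (trans (*-comm y x) xy≈0)

  x*y≉0 : ∀ {x y} → ¬ x ≈ 0# → ¬ y ≈ 0# → ¬ x * y ≈ 0#
  x*y≉0 x≉0 y≉0 xy≈0 = y≉0 (xy≈0⇒y≈0 x≉0 xy≈0)

  Positive : Carrier → Set ℓ
  Positive x = 0# ≤ᶠ x × ¬ x ≈ 0#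

  0≤1 : 0# ≤ᶠ 1#
  0≤1 with total 0# 1#
  ... | inj₁ 0≤1 = 0≤1
  ... | inj₂ 1≤0 = begin
    0#            ≤⟨ *-nonneg 0≤-1 0≤-1 ⟩
    - 1# * - 1#   ≈⟨ -1*x≈-x (- 1#) ⟩
    - - 1#        ≈⟨ -‿involutive 1# ⟩
    1#            ∎
    where
    0≤-1 : 0# ≤ᶠ - 1#
    0≤-1 = begin
      0#          ≈⟨ -‿inverseʳ 1# ⟨
      1# + - 1#   ≤⟨ +-mono-≤ (- 1#) 1≤0 ⟩
      0# + - 1#   ≈⟨ +-identityˡ (- 1#) ⟩
      - 1#        ∎

  +-nonneg : ∀ {x y} → 0# ≤ᶠ x → 0# ≤ᶠ y → 0# ≤ᶠ x + y
  +-nonneg {x} {y} 0≤x 0≤y = begin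
    0#       ≤⟨ 0≤y ⟩
    y        ≈⟨ +-identityˡ y ⟨
    0# + y   ≤⟨ +-mono-≤ y 0≤x ⟩
    x + y    ∎

  +-positiveˡ : ∀ {x y} → Positive x → 0# ≤ᶠ y → Positive (x + y)
  +-positiveˡ {x} {y} (0≤x , x≉0) 0≤y = +-nonneg 0≤x 0≤y , λ x+y≈0 → x≉0 (antisym (x≤0 x+y≈0) 0≤x)
    where
    x≤0 : x + y ≈ 0# → x ≤ᶠ 0#
    x≤0 x+y≈0 = begin
      x        ≈⟨ +-identityˡ x ⟨
      0# + x   ≤⟨ +-mono-≤ x 0≤y ⟩
      y + x    ≈⟨ +-comm y x ⟩
      x + y    ≈⟨ x+y≈0 ⟩
      0#       ∎

  +-positiveʳ : ∀ {x y} → 0# ≤ᶠ x → Positive y → Positive (x + y)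
  +-positiveʳ {x} {y} 0≤x (0≤y , y≉0) with +-positiveˡ (0≤y , y≉0) 0≤x
  ... | _ , y+x≉0 = +-nonneg 0≤x 0≤y , λ x+y≈0 → y+x≉0 (trans (+-comm y x) x+y≈0)

  *-positive : ∀ {x y} → Positive x → Positive y → Positive (x * y)
  *-positive (0≤x , x≉0) (0≤y , y≉0) = *-nonneg 0≤x 0≤y , x*y≉0 x≉0 y≉0

  ι-nonneg : ∀ n → 0# ≤ᶠ ι n
  ι-nonneg zero    = IsTotalOrder.refl ≤-isTotalOrder
  ι-nonneg (suc n) = +-nonneg 0≤1 (ι-nonneg n)

  ι-positive : ∀ {n} → 0 < n → Positive (ι n)
  ι-positive {suc n} _ = +-positiveˡ (0≤1 , λ 1≈0 → 0≉1 (sym 1≈0)) (ι-nonneg n)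

  ι-homo-+ : ∀ m n → ι (m ℕ.+ n) ≈ ι m + ι n
  ι-homo-+ zero    n = sym (+-identityˡ (ι n))
  ι-homo-+ (suc m) n = trans (+-congˡ (ι-homo-+ m n)) (sym (+-assoc 1# (ι m) (ι n)))

𝟙 : Bool → ℕ
𝟙 true  = 1
𝟙 false = 0

module _ {A : Set} where
  open ≡ using (refl)

  length-filterᵇ-∷ : ∀ (f : A → Bool) x xs →
    length (filterᵇ f (x ∷ xs)) ≡ 𝟙 (f x) ℕ.+ length (filterᵇ f xs)
  length-filterᵇ-∷ f x xs with f x
  ... | true  = refl
  ... | false = refl

  length-filterᵇ-split₃ : ∀ (f g₁ g₂ g₃ : A → Bool) xs →
    (∀ z → 𝟙 (f z) ≡ 𝟙 (g₁ z) ℕ.+ 𝟙 (g₂ z) ℕ.+ 𝟙 (g₃ z)) →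
    length (filterᵇ f xs) ≡ length (filterᵇ g₁ xs) ℕ.+ length (filterᵇ g₂ xs) ℕ.+ length (filterᵇ g₃ xs)
  length-filterᵇ-split₃ f g₁ g₂ g₃ []       split = refl
  length-filterᵇ-split₃ f g₁ g₂ g₃ (x ∷ xs) split
    rewrite length-filterᵇ-∷ f x xs | length-filterᵇ-∷ g₁ x xs | length-filterᵇ-∷ g₂ x xs
          | length-filterᵇ-∷ g₃ x xs | split x | length-filterᵇ-split₃ f g₁ g₂ g₃ xs split
    = ≡.trans (+-interchange (𝟙 (g₁ x) ℕ.+ 𝟙 (g₂ x)) (𝟙 (g₃ x)) (#g₁ ℕ.+ #g₂) #g₃)
              (≡.cong (ℕ._+ (𝟙 (g₃ x) ℕ.+ #g₃)) (+-interchange (𝟙 (g₁ x)) (𝟙 (g₂ x)) #g₁ #g₂))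
    where
    open CommutativeSemigroupProperties ℕ.+-commutativeSemigroup renaming (interchange to +-interchange)
    #g₁ #g₂ #g₃ : ℕ
    #g₁ = length (filterᵇ g₁ xs)
    #g₂ = length (filterᵇ g₂ xs)
    #g₃ = length (filterᵇ g₃ xs)

between-three : ∀ {j d} → j ≤ d → d ≤ suc (suc j) → d ≡ j ⊎ d ≡ suc j ⊎ d ≡ suc (suc j)
between-three {j} {d} j≤d d≤j+2 with ℕ.m≤n⇒m<n∨m≡n d≤j+2
... | inj₂ d≡j+2      = inj₂ (inj₂ d≡j+2)
... | inj₁ (s≤s d≤j+1) with ℕ.m≤n⇒m<n∨m≡n d≤j+1
...   | inj₂ d≡j+1      = inj₂ (inj₁ d≡j+1)
...   | inj₁ (s≤s d≤j)  = inj₁ (ℕ.≤-antisym d≤j j≤d)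

module DistanceRegularProperties {n D : ℕ} (Γ : DistanceRegular n D) where
  open DistanceRegular Γ
  open Graph graph
  open ≡ using (refl; subst)

  Adj : Fin n → Fin n → Set
  Adj x y = T (adj x y)

  adj-sym : ∀ {x y} → Adj x y → Adj y x
  adj-sym {x} {y} = subst T (symm x y)

  adj-irrefl : ∀ {x} → ¬ Adj x x
  adj-irrefl {x} = subst T (irrefl x)

  -- Within and Dist are records so that their indices can be inferred from a proof.
  record Within (m : ℕ) (x y : Fin n) : Set where
    constructor within⁺
    field within⁻ : T (within m x y)
  open Within

  within-zero⇒≡ : ∀ {x y} → Within 0 x y → x ≡ y
  within-zero⇒≡ {x} {y} (within⁺ w) with x ≟ᶠ y
  ... | yes x≡y = x≡y

  within-refl : ∀ x → Within 0 x x
  within-refl x = within⁺ (T-does-refl (x ≟ᶠ x))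
    where
    T-does-refl : (x≟x : Dec (x ≡ x)) → T (does x≟x)
    T-does-refl (yes _)   = tt
    T-does-refl (no x≢x)  = x≢x refl

  within-suc : ∀ {m x y} → Within m x y → Within (suc m) x y
  within-suc (within⁺ w) = within⁺ (Equivalence.from T-∨ (inj₁ w))

  within-cons : ∀ {m x z y} → Adj x z → Within m z y → Within (suc m) x y
  within-cons {z = z} x∼z (within⁺ w) =
    within⁺ (Equivalence.from T-∨ (inj₂ (any⁺ _ (lose (∈-allFin z) (Equivalence.from T-∧ (x∼z , w))))))

  within-uncons : ∀ {m x y} → Within (suc m) x y → Within m x y ⊎ ∃ λ z → Adj x z × Within m z y
  within-uncons {m} {x} {y} (within⁺ w) with Equivalence.to T-∨ w
  ... | inj₁ w′ = inj₁ (within⁺ w′)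
  ... | inj₂ w′ with satisfied (any⁻ _ (allFin n) w′)
  ...   | z , x∼z∧w = let (x∼z , w″) = Equivalence.to T-∧ x∼z∧w in inj₂ (z , x∼z , within⁺ w″)

  within-mono : ∀ {m m′ x y} → m ≤ m′ → Within m x y → Within m′ x y
  within-mono {m′ = m′} z≤n w rewrite within-zero⇒≡ w = within-mono-refl m′
    where
    within-mono-refl : ∀ m′ {x} → Within m′ x x
    within-mono-refl zero     = within-refl _
    within-mono-refl (suc m′) = within-suc (within-mono-refl m′)
  within-mono (s≤s m≤m′) w with within-uncons w
  ... | inj₁ w′              = within-suc (within-mono m≤m′ w′)
  ... | inj₂ (z , x∼z , w′)  = within-cons x∼z (within-mono m≤m′ w′)

  within-snoc : ∀ {m x y w} → Within m x y → Adj y w → Within (suc m) x w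
  within-snoc {zero} w y∼w rewrite within-zero⇒≡ w = within-cons y∼w (within-refl _)
  within-snoc {suc m} w y∼w with within-uncons w
  ... | inj₁ w′             = within-suc (within-snoc w′ y∼w)
  ... | inj₂ (z , x∼z , w′) = within-cons x∼z (within-snoc w′ y∼w)

  within-sym : ∀ {m x y} → Within m x y → Within m y x
  within-sym {zero} w rewrite within-zero⇒≡ w = within-refl _
  within-sym {suc m} w with within-uncons w
  ... | inj₁ w′             = within-suc (within-sym w′)
  ... | inj₂ (z , x∼z , w′) = within-snoc (within-sym w′) (adj-sym x∼z)

  record Dist (x y : Fin n) (d : ℕ) : Set where
    constructor dist⁺
    field dist⁻ : T (isDist x y d)
  open Dist

  private
    T-not⁺ : ∀ {b} → ¬ T b → T (not b)
    T-not⁺ {true}  ¬t = ¬t tt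
    T-not⁺ {false} _  = tt

    T-not⁻ : ∀ {b} → T (not b) → ¬ T b
    T-not⁻ {true} ()

  dist-refl : ∀ x → Dist x x 0
  dist-refl x = dist⁺ (within⁻ (within-refl x))

  dist⇒within : ∀ {x y d} → Dist x y d → Within d x y
  dist⇒within {d = zero}  (dist⁺ t) = within⁺ t
  dist⇒within {d = suc d} (dist⁺ t) = within⁺ (proj₁ (Equivalence.to T-∧ t))

  dist-minimal : ∀ {x y d e} → Dist x y d → e < d → ¬ Within e x y
  dist-minimal {d = suc d} (dist⁺ t) (s≤s e≤d) w =
    T-not⁻ (proj₂ (Equivalence.to T-∧ t)) (within⁻ (within-mono e≤d w))

  dist-intro : ∀ {x y d} → Within d x y → (∀ {e} → e < d → ¬ Within e x y) → Dist x y d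
  dist-intro {d = zero}  (within⁺ w) _       = dist⁺ w
  dist-intro {d = suc d} (within⁺ w) minimal =
    dist⁺ (Equivalence.from T-∧ (w , T-not⁺ (minimal ℕ.≤-refl ∘ within⁺)))

  dist-≤ : ∀ {x y d e} → Dist x y d → Within e x y → d ≤ e
  dist-≤ {d = d} {e} xy w with ℕ.≤-<-connex d e
  ... | inj₁ d≤e = d≤e
  ... | inj₂ e<d = contradiction w (dist-minimal xy e<d)

  dist-unique : ∀ {x y d e} → Dist x y d → Dist x y e → d ≡ e
  dist-unique xy xy′ = ℕ.≤-antisym (dist-≤ xy (dist⇒within xy′)) (dist-≤ xy′ (dist⇒within xy))

  dist-exists : ∀ {m x y} → Within m x y → ∃ (Dist x y)
  dist-exists {zero}          w = 0 , dist⁺ (within⁻ w)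
  dist-exists {suc m} {x} {y} w with T? (within m x y)
  ... | yes w′ = dist-exists {m} (within⁺ w′)
  ... | no ¬w′ = suc m , dist-intro w λ { (s≤s e≤m) w″ → ¬w′ (within⁻ (within-mono e≤m w″)) }

  dist-sym : ∀ {x y d} → Dist x y d → Dist y x d
  dist-sym xy = dist-intro (within-sym (dist⇒within xy)) (λ e<d w → dist-minimal xy e<d (within-sym w))

  dist-pred : ∀ {x y d} → Dist x y (suc d) → ∃ λ z → Adj x z × Dist z y d
  dist-pred xy with within-uncons (dist⇒within xy)
  ... | inj₁ w             = contradiction w (dist-minimal xy ℕ.≤-refl)
  ... | inj₂ (z , x∼z , w) =
    z , x∼z , dist-intro w (λ e<d w′ → dist-minimal xy (s≤s e<d) (within-cons x∼z w′))

  adj⇒dist₁ : ∀ {x y} → Adj x y → Dist x y 1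
  adj⇒dist₁ {x} x∼y = dist-intro (within-cons x∼y (within-refl _))
    λ { (s≤s z≤n) w → adj-irrefl (subst (Adj x) (≡.sym (within-zero⇒≡ w)) x∼y) }

  dist₁⇒adj : ∀ {x y} → Dist x y 1 → Adj x y
  dist₁⇒adj {x} xy with dist-pred xy
  ... | z , x∼z , zy = subst (Adj x) (within-zero⇒≡ (dist⇒within zy)) x∼z

  pair-at-distance : ∀ {h} → h ≤ D → ∃₂ λ x y → Dist x y h
  pair-at-distance h≤D with diam-attained
  ... | x , y , isDist≡true = descend (dist⁺ (Equivalence.from T-≡ isDist≡true)) h≤D
    where
    descend : ∀ {x d h} → Dist x y d → h ≤ d → ∃₂ λ x y → Dist x y h
    descend {x} {d} xy h≤d with ℕ.m≤n⇒m<n∨m≡n h≤d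
    ... | inj₂ refl          = x , y , xy
    ... | inj₁ (s≤s h≤d-1) with dist-pred xy
    ...   | _ , _ , zy       = descend zy h≤d-1

  count≡p : ∀ {x y h i j} → Dist x y h → h ≤ D → i ≤ D → j ≤ D → count x y i j ≡ p h i j
  count≡p {x} {y} {h} {i} {j} xy h≤D i≤D j≤D =
    regular h i j h≤D i≤D j≤D x y (Equivalence.to T-≡ (dist⁻ xy))

  p-positive : ∀ {x y z h i j} → Dist x y h → h ≤ D → i ≤ D → j ≤ D →
               Dist x z i → Dist y z j → 0 < p h i j
  p-positive {x} {y} {z} {h} {i} {j} xy h≤D i≤D j≤D xz yz = subst (0 <_) (count≡p xy h≤D i≤D j≤D)
    (List.filter-some (T? ∘ λ w → isDist x w i ∧ isDist y w j)
      (lose (∈-allFin z) (Equivalence.from T-∧ (dist⁻ xz , dist⁻ yz))))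

  a₀≡0 : 1 ≤ D → a 0 ≡ 0
  a₀≡0 1≤D with diam-attained
  ... | x , _ = begin
    a 0             ≡⟨ count≡p (dist-refl x) z≤n 1≤D z≤n ⟨
    count x x 1 0   ≡⟨ ≡.cong length (List.filter-none (T? ∘ λ z → isDist x z 1 ∧ isDist x z 0)
                         {xs = allFin n} (All.tabulate λ _ → no-common-neighbour)) ⟩
    0               ∎
    where
    open ≡.≡-Reasoning
    no-common-neighbour : ∀ {z} → ¬ T (isDist x z 1 ∧ isDist x z 0)
    no-common-neighbour {z} t with Equivalence.to (T-∧ {isDist x z 1}) t
    ... | d₁ , d₀ = ℕ.1+n≢0 (dist-unique {x} {z} {1} (dist⁺ d₁) (dist⁺ d₀))

  c-positive : ∀ j → suc j ≤ D → 0 < c (suc j)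
  c-positive j j<D with pair-at-distance j<D
  ... | x , y , xy with dist-pred xy
  ...   | z , x∼z , zy = p-positive xy j<D (ℕ.≤-trans (s≤s z≤n) j<D) (ℕ.≤-trans (ℕ.n≤1+n j) j<D)
                           (adj⇒dist₁ x∼z) (dist-sym zy)

  b-positive : ∀ i → suc i ≤ D → 0 < b i
  b-positive i i<D with pair-at-distance i<D
  ... | x , y , xy with dist-pred xy
  ...   | z , x∼z , zy = p-positive zy (ℕ.≤-trans (ℕ.n≤1+n i) i<D) (ℕ.≤-trans (s≤s z≤n) i<D) i<D
                           (adj⇒dist₁ (adj-sym x∼z)) (dist-sym xy)

  isDist-true : ∀ {x y d} → Dist x y d → isDist x y d ≡ true
  isDist-true xy = Equivalence.to T-≡ (dist⁻ xy)

  isDist-false : ∀ {x y d e} → Dist x y d → e ≢ d → isDist x y e ≡ false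
  isDist-false {x} {y} {e = e} xy e≢d with isDist x y e in isDist≡true
  ... | true  = contradiction (dist-unique (dist⁺ (Equivalence.from T-≡ isDist≡true)) xy) e≢d
  ... | false = refl

  neighbour-dist : ∀ {x y z j} → Dist x y (suc j) → Adj x z →
                   ∃ λ d → Dist y z d × (d ≡ j ⊎ d ≡ suc j ⊎ d ≡ suc (suc j))
  neighbour-dist {x} {y} {z} xy x∼z with dist-exists {D} (within⁺ (Equivalence.from T-≡ (within-D y z)))
  ... | d , yz = d , yz , between-three
      (ℕ.≤-pred (dist-≤ (dist-sym xy) (within-snoc (dist⇒within yz) (adj-sym x∼z))))
      (dist-≤ yz (within-snoc (dist⇒within (dist-sym xy)) x∼z))

  neighbour-indicator : ∀ {x y j} → Dist x y (suc j) → ∀ z →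
    𝟙 (isDist x z 1 ∧ isDist x z 1) ≡
      𝟙 (isDist x z 1 ∧ isDist y z (suc j)) ℕ.+ 𝟙 (isDist x z 1 ∧ isDist y z (suc (suc j)))
        ℕ.+ 𝟙 (isDist x z 1 ∧ isDist y z j)
  neighbour-indicator {x} {y} {j} xy z with isDist x z 1 in x∼z
  ... | false = refl
  ... | true with neighbour-dist xy (dist₁⇒adj (dist⁺ (Equivalence.from T-≡ x∼z)))
  ...   | _ , yz , inj₁ refl
    rewrite isDist-false yz (ℕ.>⇒≢ (ℕ.n<1+n j)) | isDist-false yz (ℕ.>⇒≢ (ℕ.m<n⇒m<1+n (ℕ.n<1+n j)))
          | isDist-true yz = refl
  ...   | _ , yz , inj₂ (inj₁ refl)
    rewrite isDist-false yz (ℕ.>⇒≢ (ℕ.n<1+n (suc j))) | isDist-false yz (ℕ.<⇒≢ (ℕ.n<1+n j))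
          | isDist-true yz = refl
  ...   | _ , yz , inj₂ (inj₂ refl)
    rewrite isDist-false yz (ℕ.<⇒≢ (ℕ.n<1+n (suc j))) | isDist-false yz (ℕ.<⇒≢ (ℕ.m<n⇒m<1+n (ℕ.n<1+n j)))
          | isDist-true yz = refl

  valency-split : ∀ j → suc (suc j) ≤ D → a (suc j) ℕ.+ b (suc j) ℕ.+ c (suc j) ≡ k
  valency-split j j+1<D with pair-at-distance (ℕ.<⇒≤ j+1<D)
  ... | x , y , xy = begin
    a (suc j) ℕ.+ b (suc j) ℕ.+ c (suc j)
      ≡⟨ ≡.cong₂ ℕ._+_ (≡.cong₂ ℕ._+_ (count≡p xy j+1≤D 1≤D j+1≤D) (count≡p xy j+1≤D 1≤D j+1<D))
                       (count≡p xy j+1≤D 1≤D (ℕ.≤-trans (ℕ.n≤1+n j) j+1≤D)) ⟨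
    count x y 1 (suc j) ℕ.+ count x y 1 (suc (suc j)) ℕ.+ count x y 1 j
      ≡⟨ length-filterᵇ-split₃ _ _ _ _ (allFin n) (neighbour-indicator xy) ⟨
    count x x 1 1
      ≡⟨ count≡p (dist-refl x) z≤n 1≤D 1≤D ⟩
    k ∎
    where
    open ≡.≡-Reasoning
    j+1≤D : suc j ≤ D
    j+1≤D = ℕ.<⇒≤ j+1<D
    1≤D : 1 ≤ D
    1≤D = ℕ.≤-trans (s≤s z≤n) j+1≤D

module PseudoCosineProperties {f ℓ} (F : RealClosedField f ℓ) {n D : ℕ} (Γ : DistanceRegular n D) where
  open RealClosedField F hiding (_≤_)
  open RingProperties ring using (x∙y⁻¹≈ε⇒x≈y; x≈y⇒x∙y⁻¹≈ε; +-inverseˡ-unique)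
  open CommutativeRingIdentities commutativeRing
  open OrderedFieldProperties F
  open Cosine F Γ
  open DistanceRegular Γ using (a; b; c; k)
  open DistanceRegularProperties Γ using (a₀≡0; b-positive; c-positive; valency-split)

  ι-valency : ∀ j → suc (suc j) ≤ D → ι (a (suc j)) + ι (b (suc j)) + ι (c (suc j)) ≈ ι k
  ι-valency j j+1<D = begin
    ι (a (suc j)) + ι (b (suc j)) + ι (c (suc j))   ≈⟨ +-congʳ (ι-homo-+ (a (suc j)) (b (suc j))) ⟨
    ι (a (suc j) ℕ.+ b (suc j)) + ι (c (suc j))     ≈⟨ ι-homo-+ (a (suc j) ℕ.+ b (suc j)) (c (suc j)) ⟨
    ι (a (suc j) ℕ.+ b (suc j) ℕ.+ c (suc j))       ≡⟨ ≡.cong ι (valency-split j j+1<D) ⟩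
    ι k                                             ∎
    where open SetoidReasoning setoid

  c≉0 : ∀ j → suc j ≤ D → ¬ ι (c (suc j)) ≈ 0#
  c≉0 j j<D = proj₂ (ι-positive (c-positive j j<D))

  k≉0 : 1 ≤ D → ¬ ι k ≈ 0#
  k≉0 1≤D = proj₂ (ι-positive (b-positive 0 1≤D))

  isPseudoCosine-cong : ∀ {θ x y} → (∀ i → x i ≈ y i) → IsPseudoCosine θ x → IsPseudoCosine θ y
  isPseudoCosine-cong {θ} {x} {y} x≈y (x₀≈1 , rec) = trans (sym (x≈y 0)) x₀≈1 , λ i i<D →
    trans (sym (+-cong (+-cong (cterm-cong i) (*-congˡ (x≈y i))) (*-congˡ (x≈y (suc i)))))
          (trans (rec i i<D) (*-congˡ (x≈y i)))
    where
    cterm-cong : ∀ i → cterm x i ≈ cterm y i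
    cterm-cong zero    = refl
    cterm-cong (suc i) = *-congˡ (x≈y i)

  eigenvalue≈k*second : ∀ {θ x} → 1 ≤ D → IsPseudoCosine θ x → θ ≈ ι k * x 1
  eigenvalue≈k*second 1≤D (x₀≈1 , rec) =
    eigenvalue-from-first-step (rec 0 1≤D) x₀≈1 (reflexive (≡.cong ι (a₀≡0 1≤D)))

  nontrivial⇒second≉1 : ∀ {θ x} → 1 ≤ D → IsPseudoCosine θ x → ¬ θ ≈ ι k → ¬ x 1 ≈ 1#
  nontrivial⇒second≉1 1≤D x-cos θ≉k x₁≈1 =
    θ≉k (trans (eigenvalue≈k*second 1≤D x-cos) (trans (*-congˡ x₁≈1) (*-identityʳ (ι k))))

  flat-step-recurrence : ∀ {θ x} → IsPseudoCosine θ x → ∀ j → suc (suc j) ≤ D →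
    x (suc j) ≈ x (suc (suc j)) → ι (c (suc j)) * (x j - x (suc j)) ≈ (θ - ι k) * x (suc j)
  flat-step-recurrence (_ , rec) j j+1<D flat = flat-step (rec (suc j) j+1<D) flat (ι-valency j j+1<D)

  no-consecutive-zeros : ∀ {θ x} → IsPseudoCosine θ x → ∀ i → suc i ≤ D → x i ≈ 0# → ¬ x (suc i) ≈ 0#
  no-consecutive-zeros (x₀≈1 , _)   zero    _     x₀≈0 _ = 0≉1 (trans (sym x₀≈0) x₀≈1)
  no-consecutive-zeros x-cos@(_ , rec) (suc i) i+1<D x₁≈0 x₂≈0 =
    no-consecutive-zeros x-cos i i<D
      (xy≈0⇒y≈0 (c≉0 i i<D) (zero-steps-propagate (rec (suc i) i+1<D) x₁≈0 x₂≈0)) x₁≈0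
    where
    i<D : suc i ≤ D
    i<D = ℕ.<⇒≤ i+1<D

  flat⇒nonzero : ∀ {θ x} → IsPseudoCosine θ x → ∀ j → suc (suc j) ≤ D →
    x (suc j) ≈ x (suc (suc j)) → ¬ x (suc j) ≈ 0#
  flat⇒nonzero x-cos j j+1<D flat x≈0 =
    no-consecutive-zeros x-cos (suc j) j+1<D x≈0 (trans (sym flat) x≈0)

  consecutive-flat-steps⇒trivial : ∀ {θ x} → IsPseudoCosine θ x → ∀ j → suc (suc j) ≤ D →
    x j ≈ x (suc j) → x (suc j) ≈ x (suc (suc j)) → θ ≈ ι k
  consecutive-flat-steps⇒trivial x-cos j j+1<D flat₀ flat₁ =
    x∙y⁻¹≈ε⇒x≈y _ _ (xy≈0⇒x≈0 (flat⇒nonzero x-cos j j+1<D flat₁)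
      (trans (sym (flat-step-recurrence x-cos j j+1<D flat₁))
             (trans (*-congˡ (x≈y⇒x∙y⁻¹≈ε flat₀)) (zeroʳ _))))

  tight-pair-no-common-flat-step : ∀ {θ τ η x y} →
    IsPseudoCosine θ x → ¬ θ ≈ ι k → IsPseudoCosine τ y → ¬ τ ≈ ι k → IsPseudoCosine η (λ i → x i * y i) →
    ∀ j → suc (suc j) ≤ D → x (suc j) ≈ x (suc (suc j)) → ¬ y (suc j) ≈ y (suc (suc j))
  tight-pair-no-common-flat-step {x = x} {y} x-cos θ≉k y-cos τ≉k xy-cos j j+1<D x-flat y-flat =
    x*y≉0 (x*y≉0 (x*y≉0 (k≉0 1≤D) k-c≉0) (x*y≉0 (second-1≉0 x-cos θ≉k) (second-1≉0 y-cos τ≉k)))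
          (x*y≉0 (flat⇒nonzero x-cos j j+1<D x-flat) (flat⇒nonzero y-cos j j+1<D y-flat))
      (flat-steps-of-product-eigenvalues
        (flat-steps-of-product (flat-step-recurrence x-cos j j+1<D x-flat)
                               (flat-step-recurrence y-cos j j+1<D y-flat)
                               (flat-step-recurrence xy-cos j j+1<D (*-cong x-flat y-flat)))
        (eigenvalue≈k*second 1≤D x-cos) (eigenvalue≈k*second 1≤D y-cos) (eigenvalue≈k*second 1≤D xy-cos))
    where
    1≤D : 1 ≤ D
    1≤D = ℕ.≤-trans (s≤s z≤n) j+1<D

    k-c≉0 : ¬ ι k - ι (c (suc j)) ≈ 0#
    k-c≉0 k-c≈0 = proj₂ (+-positiveʳ (ι-nonneg (a (suc j))) (ι-positive (b-positive (suc j) j+1<D)))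
      (trans (sym (x+y+z≈w⇒w-z≈x+y (ι-valency j j+1<D))) k-c≈0)

    second-1≉0 : ∀ {θ z} → IsPseudoCosine θ z → ¬ θ ≈ ι k → ¬ z 1 - 1# ≈ 0#
    second-1≉0 z-cos θ≉k = nontrivial⇒second≉1 1≤D z-cos θ≉k ∘ x∙y⁻¹≈ε⇒x≈y _ _

  StepRelated : Carrier → (ℕ → Carrier) → (ℕ → Carrier) → Set ℓ
  StepRelated ε x y = ∀ i → suc i ≤ D → StepRelation ε (x i) (y i) (x (suc i)) (y (suc i))

  tight-steps-differ : ∀ {θ τ η ε x y} →
    IsPseudoCosine θ x → ¬ θ ≈ ι k → IsPseudoCosine τ y → ¬ τ ≈ ι k → IsPseudoCosine η (λ i → x i * y i) →
    StepRelated ε x y → ¬ ε ≈ 1# → ∀ i → suc i ≤ D → ¬ x i ≈ x (suc i)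
  tight-steps-differ x-cos θ≉k _ _ _ _ _ zero 1≤D x₀≈x₁ =
    nontrivial⇒second≉1 1≤D x-cos θ≉k (trans (sym x₀≈x₁) (proj₁ x-cos))
  tight-steps-differ {ε = ε} {y = y} x-cos θ≉k y-cos τ≉k xy-cos related ε≉1 (suc j) j+1<D x-flat =
    tight-pair-no-common-flat-step x-cos θ≉k y-cos τ≉k xy-cos j j+1<D x-flat
      (sym (x∙y⁻¹≈ε⇒x≈y _ _ y-step≈0))
    where
    1-ε≉0 : ¬ 1# - ε ≈ 0#
    1-ε≉0 1-ε≈0 = ε≉1 (sym (x∙y⁻¹≈ε⇒x≈y _ _ 1-ε≈0))
    y-step≈0 : y (suc (suc j)) - y (suc j) ≈ 0#
    y-step≈0 = xy≈0⇒y≈0 (flat⇒nonzero x-cos j j+1<D x-flat)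
                 (xy≈0⇒y≈0 1-ε≉0 (step-relation-flat (related (suc j) j+1<D) x-flat))

  ¬flat-or-flip-everywhere : ∀ {θ τ x y} →
    3 ≤ D → a 1 ≢ 0 → IsPseudoCosine θ x → ¬ θ ≈ ι k → IsPseudoCosine τ y →
    ¬ (∀ i → suc i ≤ D → (x (suc i) - x i) * (y (suc i) + y i) ≈ 0#)
  ¬flat-or-flip-everywhere {θ} {τ} {x} {y} 3≤D a₁≢0 x-cos θ≉k y-cos flips =
    proj₂ (+-positiveˡ P-positive (proj₁ P-positive)) (sign-flip-steps-incompatible second third y₁≈-1)
    where
    2≤D : 2 ≤ D
    2≤D = ℕ.≤-trans (s≤s (s≤s z≤n)) 3≤D
    1≤D : 1 ≤ D
    1≤D = ℕ.≤-trans (s≤s z≤n) 2≤D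
    a₁-positive : Positive (ι (a 1))
    a₁-positive = ι-positive (ℕ.n≢0⇒n>0 a₁≢0)

    x₁≉x₀ : ¬ x 1 - x 0 ≈ 0#
    x₁≉x₀ x₁-x₀≈0 = nontrivial⇒second≉1 1≤D x-cos θ≉k (trans (x∙y⁻¹≈ε⇒x≈y _ _ x₁-x₀≈0) (proj₁ x-cos))
    y₁≈-1 : y 1 ≈ - 1#
    y₁≈-1 = trans (+-inverseˡ-unique (y 1) (y 0) (xy≈0⇒y≈0 x₁≉x₀ (flips 0 1≤D))) (-‿cong (proj₁ y-cos))
    second : ι (b 1) * (y 2 + y 1) ≈ ι (a 1) + ι (a 1)
    second = sign-flip-second-step (proj₂ y-cos 1 2≤D) (proj₁ y-cos) y₁≈-1
               (eigenvalue≈k*second 1≤D y-cos) (ι-valency 0 2≤D)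

    y₂+y₁≉0 : ¬ y 2 + y 1 ≈ 0#
    y₂+y₁≉0 y₂+y₁≈0 = proj₂ (+-positiveˡ a₁-positive (proj₁ a₁-positive))
      (trans (sym second) (trans (*-congˡ y₂+y₁≈0) (zeroʳ (ι (b 1)))))
    x₁≈x₂ : x 1 ≈ x 2
    x₁≈x₂ = sym (x∙y⁻¹≈ε⇒x≈y _ _ (xy≈0⇒x≈0 y₂+y₁≉0 (flips 1 2≤D)))
    x₃≉x₂ : ¬ x 3 - x 2 ≈ 0#
    x₃≉x₂ x₃-x₂≈0 =
      θ≉k (consecutive-flat-steps⇒trivial x-cos 1 3≤D x₁≈x₂ (sym (x∙y⁻¹≈ε⇒x≈y _ _ x₃-x₂≈0)))
    third : (ι (a 2) + ι (a 2) + ι (c 2)) * y 2 ≈ ι (c 2)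
    third = sign-flip-third-step (proj₂ y-cos 2 3≤D) (xy≈0⇒y≈0 x₃≉x₂ (flips 2 3≤D)) y₁≈-1
              (eigenvalue≈k*second 1≤D y-cos) (ι-valency 1 3≤D)

    P-positive : Positive (ι (a 2) * ι (b 1) + ι (a 1) * (ι (a 2) + ι (a 2) + ι (c 2)))
    P-positive = +-positiveʳ (*-nonneg (ι-nonneg (a 2)) (ι-nonneg (b 1)))
      (*-positive a₁-positive
        (+-positiveʳ (+-nonneg (ι-nonneg (a 2)) (ι-nonneg (a 2))) (ι-positive (c-positive 1 2≤D))))

corollary8p6 :
    ∀ {c ℓ} (F : RealClosedField c ℓ) →
    let open RealClosedField F hiding (_≤_) in
    ∀ {n D : ℕ} (Γ : DistanceRegular n D) →
    let open Cosine F Γ in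
    3 ≤ D → DistanceRegular.a Γ 1 ≢ 0 →
    (σ ρ : ℕ → Carrier) → Nontrivial σ → Nontrivial ρ → TightPair σ ρ →
    (ε : Carrier) →
    (∀ i → suc i ≤ D →
      (σ (suc i) * ρ (suc i) - σ i * ρ i) ≈ (ε * (σ i * ρ (suc i) - σ (suc i) * ρ i))) →
    ¬ (ε ≈ 1#) × ¬ (ε ≈ - 1#) ×
    (∀ i → suc i ≤ D → ¬ (σ i ≈ σ (suc i)) × ¬ (ρ i ≈ ρ (suc i)))
corollary8p6 F {D = D} Γ 3≤D a₁≢0 σ ρ (θ , σ-cos , θ≉k) (τ , ρ-cos , τ≉k) (_ , _ , η , σρ-cos)
             ε σρ-related =
  ε≉1 , ε≉-1 , λ i i<D → σ-steps-differ i i<D , ρ-steps-differ i i<D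
  where
  open RealClosedField F hiding (_≤_)
  open RingProperties ring using (-‿involutive)
  open CommutativeRingIdentities commutativeRing using (step-relation-swap; step-relation-ε≈1)
  open Cosine F Γ using (IsPseudoCosine)
  open PseudoCosineProperties F Γ

  ρσ-cos : IsPseudoCosine η (λ i → ρ i * σ i)
  ρσ-cos = isPseudoCosine-cong (λ i → *-comm (σ i) (ρ i)) σρ-cos
  ρσ-related : StepRelated (- ε) ρ σ
  ρσ-related i i<D = step-relation-swap (σρ-related i i<D)

  ε≉1 : ¬ ε ≈ 1#
  ε≉1 ε≈1 = ¬flat-or-flip-everywhere 3≤D a₁≢0 σ-cos θ≉k ρ-cos
    λ i i<D → step-relation-ε≈1 (σρ-related i i<D) ε≈1
  -ε≉1 : ¬ - ε ≈ 1#
  -ε≉1 -ε≈1 = ¬flat-or-flip-everywhere 3≤D a₁≢0 ρ-cos τ≉k σ-cos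
    λ i i<D → step-relation-ε≈1 (ρσ-related i i<D) -ε≈1
  ε≉-1 : ¬ ε ≈ - 1#
  ε≉-1 ε≈-1 = -ε≉1 (trans (-‿cong ε≈-1) (-‿involutive 1#))

  σ-steps-differ : ∀ i → suc i ≤ D → ¬ σ i ≈ σ (suc i)
  σ-steps-differ = tight-steps-differ σ-cos θ≉k ρ-cos τ≉k σρ-cos σρ-related ε≉1
  ρ-steps-differ : ∀ i → suc i ≤ D → ¬ ρ i ≈ ρ (suc i)
  ρ-steps-differ = tight-steps-differ ρ-cos τ≉k σ-cos θ≉k ρσ-cos ρσ-related -ε≉1
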